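{- Let $\langle S,\leq_S\rangle$ be a directed partial order with a minimum element, and let $\lambda$ be a cardinal. If there is a $\lambda$-dominating system on $S$, then $\mathcal{SN}\preceq_{\mathrm{T}}\mathbf{D}_S^\lambda$, where $\mathcal{SN}$ is viewed as the relational system $\langle\mathcal{SN},\mathcal{SN},\subseteq\rangle$.
   Context: A relational system is a triple $\mathbf{R}=\langle X,Y,R\rangle$ with $R\subseteq X\times Y$; $\mathfrak{b}(\mathbf{R})$ is the least size of an $E\subseteq X$ with no $y\in Y$ such that $xRy$ for all $x\in E$, and $\mathfrak{d}(\mathbf{R})$ is the least size of a $D\subseteq Y$ with $\forall x\in X\exists y\in D\,(xRy)$. For relational systems $\mathbf{R}=\langle X,Y,R\rangle$, $\mathbf{R}'=\langle X',Y',R'\rangle$, $\mathbf{R}\preceq_{\mathrm{T}}\mathbf{R}'$ (Tukey below) means there are maps $\Psi_1:X\to X'$, $\Psi_2:Y'\to Y$ such that for all $x\in X$, $y'\in Y'$, $\Psi_1(x)R'y'$ implies $xR\Psi_2(y')$. For a directed partial order $\langle S,\leq_S\rangle$ and a cardinal $\lambda$, $\mathbf{D}_S^\lambda=\langle S^\lambda,S^\lambda,\leq\rangle$ where $X\leq Y$ iff $X(\alpha)\leq_S Y(\alpha)$ for all $\alpha<\lambda$. Strong measure zero: $X\subseteq 2^\omega$ has strong measure zero iff for every $f\in\omega^\omega$ there is $\sigma\in(2^{<\omega})^\omega$ with $|\sigma(n)|=f(n)$ for all $n$ and $X\subseteq\bigcup_{n<\omega}[\sigma(n)]$ (here $[s]=\{x\in2^\omega: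 s\subseteq x\}$). $\mathcal{SN}$ is the family of strong measure zero subsets of $2^\omega$. Yorioka ideals: for $\sigma\in(2^{<\omega})^\omega$ let $\mathrm{ht}_\sigma(i)=|\sigma(i)|$ and $[\sigma]_\infty=\{x\in2^\omega:\exists^\infty n\,(\sigma(n)\subseteq x)\}$. Let $\mathrm{pw}_k(i)=i^k$ and for $f,g\in\omega^\omega$ write $f\ll g$ iff for every $k<\omega$, $f\circ\mathrm{pw}_k\leq^* g$ (eventual domination). For increasing $f\in\omega^\omega$, $\mathcal{I}_f=\{X\subseteq2^\omega:\exists\sigma\in(2^{<\omega})^\omega\,(X\subseteq[\sigma]_\infty\text{ and } f\ll\mathrm{ht}_\sigma)\}$. For increasing $f\in\omega^\omega$ and a directed partial order $S$, an $\mathcal{I}_f$ directed system on $S$ is a family $\langle A_i^f: i\in S\rangle$ of subsets of $2^\omega$ such that (I) each $A_i^f$ is a dense $G_\delta$ subset of $2^\omega$ and $A_i^f\in\mathcal{I}_f$; (II) $i\leq_S j$ implies $A_i^f\subseteq A_j^f$; (III) every member of $\mathcal{I}_f$ is contained in some $A_i^f$. If $S$ has minimum $i_0$ and $\lambda$ is a cardinal, a $\lambda$-dominating system on $S$ is a family $\langle A^{f_\gamma}:\gamma<\lambda\rangle$ where $\{f_\gamma:\gamma<\lambda\}$ is a dominating family (w.r.t. $\leq^*$) of increasing functions in $\omega^\omega$, each $A^{f_\gamma}=\langle A_i^{f_\gamma}:i\in S\rangle$ is an $\mathcal{I}_{f_\gamma}$ directed system on $S$, and for every $\gamma<\lambda$,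 $\bigcap_{\eta<\gamma}A_{i_0}^{f_\eta}\notin\mathcal{I}_{f_\gamma}$ (the empty intersection being $2^\omega$). -}

module Defs where

open import Level using (Level; _⊔_) renaming (suc to lsuc; zero to lzero)
open import Data.Nat using (ℕ; zero; suc; _≤_; _<_; _^_)
open import Data.Bool using (Bool)
open import Data.List using (List; []; _∷_; length)
open import Data.Product using (Σ; ∃; ∃-syntax; _×_; _,_; proj₁)
open import Data.Unit using (⊤)
open import Function using (_∘_)
open import Relation.Nullary using (¬_)
open import Relation.Binary.PropositionalEquality using (_≡_)
open import Relation.Binary.Structures using (IsPartialOrder; IsStrictTotalOrder)
open import Induction.WellFounded using (WellFounded)

Cantor : Set
Cantor = ℕ → Bool

Seq : Set
Seq = List Bool

-- s ≺ x  means  s ⊆ x  (s is an initial segment of x), i.e. x ∈ [s]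
_≺_ : Seq → Cantor → Set
[] ≺ x = ⊤
(b ∷ s) ≺ x = (b ≡ x 0) × (s ≺ (x ∘ suc))

Pred : Set₁
Pred = Cantor → Set

_⊆_ : Pred → Pred → Set
A ⊆ B = ∀ x → A x → B x

StrongMeasureZero : Pred → Set
StrongMeasureZero X =
  (f : ℕ → ℕ) → Σ (ℕ → Seq) λ σ →
    ((n : ℕ) → length (σ n) ≡ f n) × (∀ x → X x → ∃[ n ] (σ n ≺ x))

_≤*_ : (ℕ → ℕ) → (ℕ → ℕ) → Set
f ≤* g = ∃[ N ] ((n : ℕ) → N ≤ n → f n ≤ g n)

Increasing : (ℕ → ℕ) → Set
Increasing f = (m n : ℕ) → m < n → f m < f n

pw : ℕ → ℕ → ℕ
pw k i = i ^ k

_≪_ : (ℕ → ℕ) → (ℕ → ℕ) → Set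
f ≪ g = (k : ℕ) → (f ∘ pw k) ≤* g

ht : (ℕ → Seq) → ℕ → ℕ
ht σ i = length (σ i)

[_]∞ : (ℕ → Seq) → Pred
[ σ ]∞ x = (m : ℕ) → ∃[ n ] (m ≤ n × σ n ≺ x)

-- membership in I_f (for f increasing)
Yorioka : (ℕ → ℕ) → Pred → Set
Yorioka f X = Σ (ℕ → Seq) λ σ → (X ⊆ [ σ ]∞) × (f ≪ ht σ)

IsOpen : Pred → Set
IsOpen U = ∀ x → U x → Σ Seq λ s → (s ≺ x) × (∀ y → s ≺ y → U y)

IsGδ : Pred → Set₁
IsGδ A = Σ (ℕ → Pred) λ U →
  ((n : ℕ) → IsOpen (U n)) × (∀ x → (A x → ∀ n → U n x) × ((∀ n → U n x) → A x))

IsDense : Pred → Set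
IsDense A = (s : Seq) → ∃[ x ] (s ≺ x × A x)

record DirectedPO : Set₁ where
  field
    Carrier : Set
    _≤S_ : Carrier → Carrier → Set
    isPartialOrder : IsPartialOrder _≡_ _≤S_
    directed : (i j : Carrier) → ∃[ k ] (i ≤S k × j ≤S k)

HasMinimum : (S : DirectedPO) → DirectedPO.Carrier S → Set
HasMinimum S i₀ = ∀ i → DirectedPO._≤S_ S i₀ i

-- Cardinals: a cardinal λ is represented by its initial ordinal,
-- i.e. a type Λ with a well-order _<_ such that Λ does not inject into
-- any proper initial segment { η : η < γ }.

record Cardinal : Set₁ where
  field
    Λ : Set
    _<Λ_ : Λ → Λ → Set
    isStrictTotalOrder : IsStrictTotalOrder _≡_ _<Λ_
    wellFounded : WellFounded _<Λ_
    initial : (γ : Λ) → ¬ (Σ (Λ → Σ Λ (λ η → η <Λ γ)) λ h →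
                         (a b : Λ) → proj₁ (h a) ≡ proj₁ (h b) → a ≡ b)

module _ (S : DirectedPO) where
  open DirectedPO S renaming (Carrier to Sc)

  IsYoriokaDirectedSystem : (ℕ → ℕ) → (Sc → Pred) → Set₁
  IsYoriokaDirectedSystem f A =
    ((i : Sc) → IsDense (A i) × IsGδ (A i) × Yorioka f (A i)) ×
    ((i j : Sc) → i ≤S j → A i ⊆ A j) ×
    ((X : Pred) → Yorioka f X → Σ Sc λ i → X ⊆ A i)

  module _ (i₀ : Sc) (κ : Cardinal) where
    open Cardinal κ

    IsDominatingSystem : (Λ → ℕ → ℕ) → (Λ → Sc → Pred) → Set₁
    IsDominatingSystem f A =
      ((γ : Λ) → Increasing (f γ)) ×
      ((g : ℕ → ℕ) → Σ Λ λ γ → g ≤* f γ) ×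
      ((γ : Λ) → IsYoriokaDirectedSystem (f γ) (A γ)) ×
      ((γ : Λ) → ¬ Yorioka (f γ) (λ x → (η : Λ) → η <Λ γ → A η i₀ x))

    HasDominatingSystem : Set₁
    HasDominatingSystem = Σ (Λ → ℕ → ℕ) λ f → Σ (Λ → Sc → Pred) λ A →
      IsDominatingSystem f A

record RelSys (a b r : Level) : Set (lsuc (a ⊔ b ⊔ r)) where
  field
    X : Set a
    Y : Set b
    R : X → Y → Set r

_≼T_ : ∀ {a b r a' b' r'} → RelSys a b r → RelSys a' b' r' → Set (a ⊔ b ⊔ r ⊔ a' ⊔ b' ⊔ r')
𝐑 ≼T 𝐑' =
  Σ (RelSys.X 𝐑 → RelSys.X 𝐑') λ Ψ₁ →
  Σ (RelSys.Y 𝐑' → RelSys.Y 𝐑) λ Ψ₂ →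
    ∀ x y' → RelSys.R 𝐑' (Ψ₁ x) y' → RelSys.R 𝐑 x (Ψ₂ y')

SNset : Set₁
SNset = Σ Pred StrongMeasureZero

𝐒𝐍 : RelSys (lsuc lzero) (lsuc lzero) lzero
𝐒𝐍 = record { X = SNset ; Y = SNset ; R = λ A B → proj₁ A ⊆ proj₁ B }

𝐃 : (S : DirectedPO) (κ : Cardinal) → RelSys lzero lzero lzero
𝐃 S κ = record
  { X = Cardinal.Λ κ → DirectedPO.Carrier S
  ; Y = Cardinal.Λ κ → DirectedPO.Carrier S
  ; R = λ F G → (α : Cardinal.Λ κ) → DirectedPO._≤S_ S (F α) (G α)
  }

module Submission where

-- The Tukey maps are
--   Ψ₁ X     = (γ ↦ some i with X ⊆ A^{f_γ}_i),   Ψ₂ y = ⋂_γ A^{f_γ}_{y(γ)},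
-- and Ψ₁ X ≤ y ⇒ X ⊆ Ψ₂ y is just monotonicity of each directed system.
-- Two facts about Yorioka ideals make these maps well defined:
--   * SN ⊆ I_f for every increasing f (so Ψ₁ exists, by cofinality of A^{f_γ}).
--     Using a zig-zag enumeration of ℕ × ℕ, countably many strong measure zero
--     covers of X are merged into one sequence σ with X ⊆ [σ]_∞ and
--     ht σ(i) = f(i^i); and f ≪ (i ↦ f(i^i)).
--   * a set lying in I_f for arbitrarily fast f (w.r.t. ≤*) is strong measure
--     zero (so Ψ₂ y ∈ SN, since {f_γ} is dominating): cut the sequence σ
--     witnessing X ∈ I_f down to the required lengths g ≤* f ≤* ht σ.

open import Defs
open import Data.Nat using (ℕ; zero; suc; _+_; _≤_; _^_; z≤n; s≤s)
open import Data.Nat.Properties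
open import Data.Bool using (false)
open import Data.List using ([]; _∷_; length)
open import Data.Product using (Σ; ∃-syntax; _×_; _,_; proj₁; proj₂)
open import Data.Sum using (inj₁; inj₂)
open import Data.Unit using (tt)
open import Function using (_∘_)
open import Relation.Binary.PropositionalEquality using (_≡_; refl; sym; trans; cong; subst)

next : ℕ × ℕ → ℕ × ℕ
next (a , suc b) = (suc a , b)
next (a , zero)  = (zero , suc a)

unpair : ℕ → ℕ × ℕ
unpair zero    = (0 , 0)
unpair (suc i) = next (unpair i)

unpair-proj₁≤ : ∀ i → proj₁ (unpair i) ≤ i
unpair-proj₁≤ zero = z≤n
unpair-proj₁≤ (suc i) with unpair i | unpair-proj₁≤ i
... | (a , suc b) | a≤i = s≤s a≤i
... | (a , zero)  | _   = z≤n

unpair-onto : ∀ s a b → a + b ≡ s → ∃[ i ] unpair i ≡ (a , b)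
unpair-onto _ zero zero _ = 0 , refl
unpair-onto s (suc a) b eq
  with i , e ← unpair-onto s a (suc b) (trans (+-suc a b) eq) = suc i , cong next e
unpair-onto (suc s) zero (suc b) eq
  with i , e ← unpair-onto s b zero (trans (+-identityʳ b) (suc-injective eq)) = suc i , cong next e

pair : ℕ → ℕ → ℕ
pair m n = proj₁ (unpair-onto (m + n) m n refl)

unpair-pair : ∀ m n → unpair (pair m n) ≡ (m , n)
unpair-pair m n = proj₂ (unpair-onto (m + n) m n refl)

-- The index of (m , n) is at least m, which makes the merged cover infinite.
m≤pair : ∀ m n → m ≤ pair m n
m≤pair m n = subst (λ p → proj₁ p ≤ pair m n) (unpair-pair m n) (unpair-proj₁≤ (pair m n))

resize : ℕ → Seq → Seq
resize zero    s       = []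
resize (suc k) []      = false ∷ resize k []
resize (suc k) (b ∷ s) = b ∷ resize k s

length-resize : ∀ k s → length (resize k s) ≡ k
length-resize zero    s       = refl
length-resize (suc k) []      = cong suc (length-resize k [])
length-resize (suc k) (b ∷ s) = cong suc (length-resize k s)

resize-≺ : ∀ k s x → k ≤ length s → s ≺ x → resize k s ≺ x
resize-≺ zero    s       x _         _           = tt
resize-≺ (suc k) (b ∷ s) x (s≤s k≤n) (b≡x₀ , s≺) = b≡x₀ , resize-≺ k s (x ∘ suc) k≤n s≺

increasing⇒monotone : ∀ f → Increasing f → ∀ {m n} → m ≤ n → f m ≤ f n
increasing⇒monotone f inc {m} {n} m≤n with m≤n⇒m<n∨m≡n m≤n
... | inj₁ m<n  = <⇒≤ (inc m n m<n)
... | inj₂ refl = ≤-refl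

≪⇒≤* : ∀ {f g} → f ≪ g → f ≤* g
≪⇒≤* {f} {g} f≪g with N , f∘pw₁≤g ← f≪g 1 =
  N , λ n N≤n → subst (λ t → f t ≤ g n) (^-identityʳ n) (f∘pw₁≤g n N≤n)

≪-diagonal : ∀ f → Increasing f → f ≪ (λ i → f (i ^ i))
≪-diagonal f inc k = suc k , λ where
  (suc i) (s≤s k≤i) → increasing⇒monotone f inc (^-monoʳ-≤ (suc i) (m≤n⇒m≤1+n k≤i))

yorioka-⊆ : ∀ f {X Y} → X ⊆ Y → Yorioka f Y → Yorioka f X
yorioka-⊆ _ X⊆Y (σ , Y⊆σ∞ , f≪ht) = σ , (λ x → Y⊆σ∞ x ∘ X⊆Y x) , f≪ht

-- A strong measure zero set is covered infinitely often by a sequence with any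
-- prescribed heights H: merge the covers τ_m (the m-th one of heights
-- n ↦ H(pair m n)) by placing τ_m(n) at index pair m n ≥ m.
smz⇒∞-cover : ∀ {X} → StrongMeasureZero X → (H : ℕ → ℕ) →
  Σ (ℕ → Seq) λ σ → ((i : ℕ) → ht σ i ≡ H i) × (X ⊆ [ σ ]∞)
smz⇒∞-cover {X} smz H = σ , (λ i → length-resize (H i) _) , covers
  where
  τ : ℕ → ℕ → Seq
  τ m = proj₁ (smz (λ n → H (pair m n)))

  σ : ℕ → Seq
  σ i = resize (H i) (τ (proj₁ (unpair i)) (proj₂ (unpair i)))

  covers : X ⊆ [ σ ]∞
  covers x Xx m with n , τmn≺x ← proj₂ (proj₂ (smz (λ n → H (pair m n)))) x Xx =
    pair m n , m≤pair m n , subst (λ p → resize (H (pair m n)) (τ (proj₁ p) (proj₂ p)) ≺ x)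
                              (sym (unpair-pair m n)) σ-at-pair≺x
    where
    σ-at-pair≺x : resize (H (pair m n)) (τ m n) ≺ x
    σ-at-pair≺x = resize-≺ _ (τ m n) x
      (≤-reflexive (sym (proj₁ (proj₂ (smz (λ n → H (pair m n)))) n))) τmn≺x

smz⇒yorioka : ∀ f → Increasing f → ∀ X → StrongMeasureZero X → Yorioka f X
smz⇒yorioka f inc X smz with σ , ht≡ , covers ← smz⇒∞-cover smz (λ i → f (i ^ i)) =
  σ , covers , λ k → let N , le = ≪-diagonal f inc k in
    N , λ i N≤i → subst (f (i ^ k) ≤_) (sym (ht≡ i)) (le i N≤i)

-- A set in I_f for arbitrarily fast-growing f is strong measure zero: for target
-- lengths g ≤* f ≤* ht σ, the resized σ(n) cover X (X is hit beyond both thresholds).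
yorioka-unbounded⇒smz : ∀ X → ((g : ℕ → ℕ) → Σ (ℕ → ℕ) λ f → g ≤* f × Yorioka f X) →
  StrongMeasureZero X
yorioka-unbounded⇒smz X yor g
  with f , (N , g≤f) , σ , X⊆σ∞ , f≪ht ← yor g
  with M , f≤ht ← ≪⇒≤* f≪ht =
  (λ n → resize (g n) (σ n)) , (λ n → length-resize (g n) (σ n)) , covers
  where
  covers : ∀ x → X x → ∃[ n ] (resize (g n) (σ n) ≺ x)
  covers x Xx with n , N+M≤n , σn≺x ← X⊆σ∞ x Xx (N + M) =
    n , resize-≺ (g n) (σ n) x
          (≤-trans (g≤f n (≤-trans (m≤m+n N M) N+M≤n)) (f≤ht n (≤-trans (m≤n+m M N) N+M≤n)))
          σn≺x

theorem3p6 : (S : DirectedPO) (i₀ : DirectedPO.Carrier S) → HasMinimum S i₀ →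
    (κ : Cardinal) → HasDominatingSystem S i₀ κ → 𝐒𝐍 ≼T 𝐃 S κ
theorem3p6 S i₀ _ κ (f , A , increasing , dominating , system , _) = Ψ₁ , Ψ₂ , tukey
  where
  open DirectedPO S using (Carrier)
  open Cardinal κ using (Λ)

  index : (X : SNset) (γ : Λ) → Σ Carrier λ i → proj₁ X ⊆ A γ i
  index (X , smz) γ = proj₂ (proj₂ (system γ)) X (smz⇒yorioka (f γ) (increasing γ) X smz)

  Ψ₁ : SNset → Λ → Carrier
  Ψ₁ X γ = proj₁ (index X γ)

  -- ⋂_γ A^{f_γ}_{y γ} lies in every I_{f γ}, and the f γ are dominating.
  Ψ₂ : (Λ → Carrier) → SNset
  Ψ₂ y = ⋂ , yorioka-unbounded⇒smz ⋂ λ g → let γ , g≤f = dominating g in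
      f γ , g≤f , yorioka-⊆ (f γ) (λ x x∈⋂ → x∈⋂ γ) (proj₂ (proj₂ (proj₁ (system γ) (y γ))))
    where
    ⋂ : Pred
    ⋂ x = ∀ γ → A γ (y γ) x

  -- Monotonicity of each directed system.
  tukey : ∀ X y → RelSys.R (𝐃 S κ) (Ψ₁ X) y → RelSys.R 𝐒𝐍 X (Ψ₂ y)
  tukey X y Ψ₁X≤y x Xx γ = proj₁ (proj₂ (system γ)) _ _ (Ψ₁X≤y γ) x (proj₂ (index X γ) x Xx)
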